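{- Let $B_P$ be a basis matrix of a number lattice, with rows $b_1,\dots,b_m$ and Gram–Schmidt orthogonalization $b_1^*,\dots,b_m^*$, $b_i^*=b_i-\sum_{j<i}\alpha_{ij}b_j^*$, $\alpha_{ij}=\langle b_i,b_j^*\rangle/\langle b_j^*,b_j^*\rangle$. Let $B_P^{(2+)}$ be the unique matrix with $\mathrm{row}(B_P^{(2+)})=\mathrm{row}(B_P)$ and $B_P(B_P^{(2+)})^T=I_m$, and let $B_P^{(2)}$ be obtained from $B_P^{(2+)}$ by reversing the order of its rows. Let $\delta\in(\tfrac14,1)$. 1. If $B_P$ satisfies the size reduction condition ($|\alpha_{ij}|\le\tfrac12$ for all $j<i$), then the Gram–Schmidt coefficients $\alpha'_{ij}$ of $B_P^{(2)}$ satisfy $|\alpha'_{(i+1)i}|\le\tfrac12$ for $i=1,\dots,m-1$. 2. If $B_P$ satisfies the Lovász condition with parameter $\delta$ with respect to its Gram–Schmidt orthogonalization, i.e. $\alpha_{(i+1)i}^2\|b_i^*\|^2+\|b_{i+1}^*\|^2\ge\delta\|b_i^*\|^2$ for $i=1,\dots,m-1$, then $B_P^{(2)}$ satisfies the Lovász condition with parameter $\delta$ with respect to its own Gram–Schmidt orthogonalization.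
   Context: Vectors are over $\mathbb{Q}$ and written as rows; $\mathrm{row}(A)$ is the row space of $A$; $\|\cdot\|$ is the Euclidean norm. A basis matrix of a number lattice is a matrix with linearly independent rows generating the lattice by integer combinations. The Gram–Schmidt orthogonalization of a matrix with linearly independent rows $c_1,\dots,c_m$ is $c_1^*=c_1$, $c_i^*=c_i-\sum_{j<i}\gamma_{ij}c_j^*$ with $\gamma_{ij}=\langle c_i,c_j^*\rangle/\langle c_j^*,c_j^*\rangle$; the Lovász condition with parameter $\delta$ is $\gamma_{(i+1)i}^2\|c_i^*\|^2+\|c_{i+1}^*\|^2\ge\delta\|c_i^*\|^2$ for all $i$. -}

module Defs where

open import Data.Nat using (ℕ; zero; suc)
open import Data.Fin using (Fin; zero; suc; toℕ; inject₁; fromℕ; opposite)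
open import Data.Rational using (ℚ; 0ℚ; 1ℚ; _+_; _*_; _-_; _÷_; ≢-nonZero)
open import Data.Rational.Properties using (_≟_)
open import Relation.Nullary using (yes; no)
open import Relation.Binary.PropositionalEquality using (_≡_)
open import Data.Product using (∃)
open import Function.Bundles using (_⇔_)

Vecℚ : ℕ → Set
Vecℚ n = Fin n → ℚ

Mat : ℕ → ℕ → Set
Mat m n = Fin m → Vecℚ n

Σ[_] : ∀ {k} → (Fin k → ℚ) → ℚ
Σ[_] {zero}  f = 0ℚ
Σ[_] {suc k} f = f zero + Σ[ (λ i → f (suc i)) ]

_⊕_ : ∀ {n} → Vecℚ n → Vecℚ n → Vecℚ n
(u ⊕ v) k = u k + v k

_⊖_ : ∀ {n} → Vecℚ n → Vecℚ n → Vecℚ n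
(u ⊖ v) k = u k - v k

_·_ : ∀ {n} → ℚ → Vecℚ n → Vecℚ n
(c · v) k = c * v k

zeroV : ∀ {n} → Vecℚ n
zeroV k = 0ℚ

ΣV : ∀ {k n} → (Fin k → Vecℚ n) → Vecℚ n
ΣV vs l = Σ[ (λ i → vs i l) ]

⟨_,_⟩ : ∀ {n} → Vecℚ n → Vecℚ n → ℚ
⟨ u , v ⟩ = Σ[ (λ k → u k * v k) ]

‖_‖² : ∀ {n} → Vecℚ n → ℚ
‖ v ‖² = ⟨ v , v ⟩

-- total division (p / 0 := 0); only ever applied with nonzero
-- denominators for matrices with linearly independent rows
_/ℚ_ : ℚ → ℚ → ℚ
p /ℚ q with q ≟ 0ℚ
... | yes _  = 0ℚ
... | no q≢0 = _÷_ p q {{≢-nonZero q≢0}}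

snoc : ∀ {m} {A : Set} → (Fin m → A) → A → Fin (suc m) → A
snoc {zero}  f a zero    = a
snoc {suc m} f a zero    = f zero
snoc {suc m} f a (suc i) = snoc (λ j → f (suc j)) a i

-- Gram–Schmidt orthogonalization c₁*,…,cₘ* of the rows of c:
--   c₁* = c₁,  cᵢ* = cᵢ − Σ_{j<i} γᵢⱼ cⱼ*,  γᵢⱼ = ⟨cᵢ,cⱼ*⟩/⟨cⱼ*,cⱼ*⟩
-- (defined by recursion on the number of rows: the GSO of the first
--  m rows is unchanged when a row is appended)
gso : ∀ {m n} → Mat m n → Mat m n
gso {zero}  c ()
gso {suc m} c =
  snoc prev (c (fromℕ m) ⊖ ΣV (λ j → (⟨ c (fromℕ m) , prev j ⟩ /ℚ ‖ prev j ‖²) · prev j))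
  where
    prev : Mat m _
    prev = gso (λ i → c (inject₁ i))

-- Gram–Schmidt coefficient γᵢⱼ = ⟨cᵢ,cⱼ*⟩/⟨cⱼ*,cⱼ*⟩ (meaningful for j < i)
gsCoeff : ∀ {m n} → Mat m n → Fin m → Fin m → ℚ
gsCoeff c i j = ⟨ c i , gso c j ⟩ /ℚ ‖ gso c j ‖²

lincomb : ∀ {m n} → Vecℚ m → Mat m n → Vecℚ n
lincomb x A = ΣV (λ i → x i · A i)

LinIndepRows : ∀ {m n} → Mat m n → Set
LinIndepRows {m} A = ∀ (x : Vecℚ m) → (∀ k → lincomb x A k ≡ 0ℚ) → ∀ i → x i ≡ 0ℚ

-- A is a basis matrix of a number lattice: its rows (rational vectors)
-- are linearly independent (the lattice is their integer span)
IsLatticeBasis : ∀ {m n} → Mat m n → Set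
IsLatticeBasis = LinIndepRows

_∈row_ : ∀ {m n} → Vecℚ n → Mat m n → Set
_∈row_ {m} v A = ∃ λ (x : Vecℚ m) → ∀ k → lincomb x A k ≡ v k

SameRowSpace : ∀ {m m' n} → Mat m n → Mat m' n → Set
SameRowSpace {n = n} A D = ∀ (v : Vecℚ n) → (v ∈row A) ⇔ (v ∈row D)

RightInverseT : ∀ {m n} → Mat m n → Mat m n → Set
RightInverseT A D = ∀ i j → ⟨ A i , D j ⟩ ≡ (δij i j)
  where
    δij : ∀ {m} → Fin m → Fin m → ℚ
    δij zero    zero    = 1ℚ
    δij zero    (suc _) = 0ℚ
    δij (suc _) zero    = 0ℚ
    δij (suc i) (suc j) = δij i j

revRows : ∀ {m n} → Mat m n → Mat m n
revRows D i = D (opposite i)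

module Submission where

-- Write b*ⱼ for the Gram–Schmidt vectors of B, Nⱼ = ‖b*ⱼ‖², D for the dual basis
-- (B Dᵀ = I, row(D) = row(B)), D⁽²⁾ for D with reversed rows, o for index reversal.
--  (1) The recursive `gso` satisfies cᵢ* = cᵢ − Σ_{j<i} γᵢⱼ cⱼ* (gso-formula).
--  (2) Triangularity and B Dᵀ = I give ⟨b*ⱼ, Dᵢ⟩ = δᵢⱼ for j ≤ i; hence Nⱼ ≠ 0, the
--      b*ⱼ are pairwise orthogonal, and each Dᵢ ∈ row(B) is its orthogonal
--      expansion Σₗ (⟨Dᵢ,b*ₗ⟩/Nₗ) b*ₗ.
--  (3) By strong induction the Gram–Schmidt vectors of D⁽²⁾ are b*_{o i}/N_{o i};
--      so ‖d*ᵢ‖² = 1/N_{o i} and α'_{(i+1)i} = −α_{(o i)(o (i+1))}.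
--  (4) Size reduction transfers since |−α| = |α|; the Lovász inequality
--      δNⱼ ≤ α²Nⱼ + Nⱼ₊₁ transfers after multiplication by 1/(NⱼNⱼ₊₁).

open import Defs
open import Data.Nat using (suc) renaming (_<_ to _<ℕ_)
open import Data.Fin using (Fin; toℕ)
open import Data.Rational using (ℚ; _<_; _≤_; _+_; _*_; ∣_∣; ½; 1ℚ; _/_)
open import Data.Integer using (+_)
open import Data.Product using (_×_)
open import Relation.Binary.PropositionalEquality using (_≡_)

open import Data.Nat as ℕ using (ℕ; zero)
import Data.Nat.Properties as ℕP
open import Data.Fin using (zero; suc; inject₁; fromℕ; opposite)
import Data.Fin.Properties as FP
open import Data.Fin.Relation.Unary.Top using (view; ‵fromℕ; ‵inject₁)
open import Data.Rational using (0ℚ; _-_; -_; ≢-nonZero; nonNegative; nonPositive)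
import Data.Rational.Properties as QP
open import Data.Rational.Solver using (module +-*-Solver)
open +-*-Solver
open import Relation.Binary.PropositionalEquality
  using (refl; sym; trans; cong; cong₂; subst; subst₂; _≢_; module ≡-Reasoning)
open import Relation.Nullary using (yes; no; ¬_)
open import Data.Empty using (⊥-elim)
open import Data.Sum using (inj₁; inj₂)
open import Data.Product using (∃; _,_)
open import Relation.Binary.Definitions using (tri<; tri≈; tri>)
open import Function.Bundles using (Equivalence)

Σ-cong : ∀ {k} {f g : Fin k → ℚ} → (∀ i → f i ≡ g i) → Σ[ f ] ≡ Σ[ g ]
Σ-cong {zero}  h = refl
Σ-cong {suc k} h = cong₂ _+_ (h zero) (Σ-cong (λ i → h (suc i)))

Σ-zero : ∀ {k} {f : Fin k → ℚ} → (∀ i → f i ≡ 0ℚ) → Σ[ f ] ≡ 0ℚ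
Σ-zero {zero}  h = refl
Σ-zero {suc k} h = trans (cong₂ _+_ (h zero) (Σ-zero (λ i → h (suc i)))) (QP.+-identityʳ 0ℚ)

Σ-+ : ∀ {k} (f g : Fin k → ℚ) → Σ[ (λ i → f i + g i) ] ≡ Σ[ f ] + Σ[ g ]
Σ-+ {zero}  f g = refl
Σ-+ {suc k} f g =
  trans (cong (_+_ (f zero + g zero)) (Σ-+ (λ i → f (suc i)) (λ i → g (suc i))))
        (solve 4 (λ a b c d → (a :+ b) :+ (c :+ d) := (a :+ c) :+ (b :+ d)) refl
               (f zero) (g zero) (Σ[ (λ i → f (suc i)) ]) (Σ[ (λ i → g (suc i)) ]))

Σ-- : ∀ {k} (f g : Fin k → ℚ) → Σ[ (λ i → f i - g i) ] ≡ Σ[ f ] - Σ[ g ]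
Σ-- {zero}  f g = refl
Σ-- {suc k} f g =
  trans (cong (_+_ (f zero - g zero)) (Σ-- (λ i → f (suc i)) (λ i → g (suc i))))
        (solve 4 (λ a b c d → (a :- b) :+ (c :- d) := (a :+ c) :- (b :+ d)) refl
               (f zero) (g zero) (Σ[ (λ i → f (suc i)) ]) (Σ[ (λ i → g (suc i)) ]))

Σ-*ˡ : ∀ {k} (c : ℚ) (f : Fin k → ℚ) → c * Σ[ f ] ≡ Σ[ (λ i → c * f i) ]
Σ-*ˡ {zero}  c f = QP.*-zeroʳ c
Σ-*ˡ {suc k} c f =
  trans (QP.*-distribˡ-+ c (f zero) _) (cong (_+_ (c * f zero)) (Σ-*ˡ c (λ i → f (suc i))))

Σ-*ʳ : ∀ {k} (c : ℚ) (f : Fin k → ℚ) → Σ[ f ] * c ≡ Σ[ (λ i → f i * c) ]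
Σ-*ʳ c f = trans (QP.*-comm _ c) (trans (Σ-*ˡ c f) (Σ-cong (λ i → QP.*-comm c (f i))))

Σ-swap : ∀ {k l} (f : Fin k → Fin l → ℚ)
  → Σ[ (λ i → Σ[ (λ j → f i j) ]) ] ≡ Σ[ (λ j → Σ[ (λ i → f i j) ]) ]
Σ-swap {zero} {l} f = sym (Σ-zero {l} (λ j → refl))
Σ-swap {suc k} f =
  trans (cong (_+_ (Σ[ (λ j → f zero j) ])) (Σ-swap (λ i → f (suc i))))
        (sym (Σ-+ (λ j → f zero j) (λ j → Σ[ (λ i → f (suc i) j) ])))

Σ-single : ∀ {k} (f : Fin k → ℚ) (i : Fin k) → (∀ j → j ≢ i → f j ≡ 0ℚ) → Σ[ f ] ≡ f i
Σ-single {suc k} f zero h =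
  trans (cong (_+_ (f zero)) (Σ-zero (λ j → h (suc j) (λ ())))) (QP.+-identityʳ (f zero))
Σ-single {suc k} f (suc i) h =
  trans (cong₂ _+_ (h zero (λ ()))
                   (Σ-single (λ j → f (suc j)) i (λ j j≢i → h (suc j) (λ e → j≢i (FP.suc-injective e)))))
        (QP.+-identityˡ (f (suc i)))

Σ-last : ∀ {k} (f : Fin (suc k) → ℚ) → Σ[ f ] ≡ Σ[ (λ j → f (inject₁ j)) ] + f (fromℕ k)
Σ-last {zero}  f = trans (QP.+-identityʳ (f zero)) (sym (QP.+-identityˡ (f zero)))
Σ-last {suc k} f =
  trans (cong (_+_ (f zero)) (Σ-last (λ j → f (suc j))))
        (sym (QP.+-assoc (f zero) (Σ[ (λ j → f (suc (inject₁ j))) ]) (f (suc (fromℕ k)))))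

Σ-drop-last : ∀ {k} (f : Fin (suc k) → ℚ) → f (fromℕ k) ≡ 0ℚ → Σ[ f ] ≡ Σ[ (λ j → f (inject₁ j)) ]
Σ-drop-last f last≡0 =
  trans (Σ-last f) (trans (cong (_+_ (Σ[ (λ j → f (inject₁ j)) ])) last≡0) (QP.+-identityʳ _))

Σ-reverse : ∀ {k} (f : Fin k → ℚ) → Σ[ f ] ≡ Σ[ (λ j → f (opposite j)) ]
Σ-reverse {zero}  f = refl
Σ-reverse {suc k} f = begin
    Σ[ f ]
  ≡⟨ Σ-last f ⟩
    Σ[ (λ j → f (inject₁ j)) ] + f (fromℕ k)
  ≡⟨ cong (_+ f (fromℕ k)) (Σ-reverse (λ j → f (inject₁ j))) ⟩
    Σ[ (λ j → f (inject₁ (opposite j))) ] + f (fromℕ k)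
  ≡⟨ QP.+-comm (Σ[ (λ j → f (inject₁ (opposite j))) ]) (f (fromℕ k)) ⟩
    Σ[ (λ j → f (opposite j)) ] ∎
  where open ≡-Reasoning

Σ-nonneg : ∀ {k} (f : Fin k → ℚ) → (∀ i → 0ℚ ≤ f i) → 0ℚ ≤ Σ[ f ]
Σ-nonneg {zero}  f h = QP.≤-refl
Σ-nonneg {suc k} f h =
  subst (_≤ Σ[ f ]) (QP.+-identityʳ 0ℚ) (QP.+-mono-≤ (h zero) (Σ-nonneg (λ i → f (suc i)) (λ i → h (suc i))))

-- below a b x is x when a < b and 0 otherwise, so that sums over j < i become
-- sums over all j; notBelow a b x is the complementary part.

below : ℕ → ℕ → ℚ → ℚ
below a b x with a ℕ.<? b
... | yes _ = x
... | no  _ = 0ℚ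

notBelow : ℕ → ℕ → ℚ → ℚ
notBelow a b x with a ℕ.<? b
... | yes _ = 0ℚ
... | no  _ = x

below+notBelow : ∀ a b x → x ≡ below a b x + notBelow a b x
below+notBelow a b x with a ℕ.<? b
... | yes _ = sym (QP.+-identityʳ x)
... | no  _ = sym (QP.+-identityˡ x)

below-yes : ∀ {a b} x → a ℕ.< b → below a b x ≡ x
below-yes {a} {b} x a<b with a ℕ.<? b
... | yes _   = refl
... | no  a≮b = ⊥-elim (a≮b a<b)

below-cong : ∀ a b {x y} → (a ℕ.< b → x ≡ y) → below a b x ≡ below a b y
below-cong a b h with a ℕ.<? b
... | yes a<b = h a<b
... | no  _   = refl

below-vanish : ∀ a b {x} → (a ℕ.< b → x ≡ 0ℚ) → below a b x ≡ 0ℚ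
below-vanish a b h with a ℕ.<? b
... | yes a<b = h a<b
... | no  _   = refl

below-*ʳ : ∀ a b x y → below a b x * y ≡ below a b (x * y)
below-*ʳ a b x y with a ℕ.<? b
... | yes _ = refl
... | no  _ = QP.*-zeroˡ y

notBelow-no : ∀ {a b} x → ¬ (a ℕ.< b) → notBelow a b x ≡ x
notBelow-no {a} {b} x a≮b with a ℕ.<? b
... | yes a<b = ⊥-elim (a≮b a<b)
... | no  _   = refl

notBelow-vanish : ∀ a b {x} → (¬ (a ℕ.< b) → x ≡ 0ℚ) → notBelow a b x ≡ 0ℚ
notBelow-vanish a b h with a ℕ.<? b
... | yes _   = refl
... | no  a≮b = h a≮b

Σ-split-at : ∀ {k} (f : Fin k → ℚ) (i : Fin k) → (∀ j → toℕ i ℕ.< toℕ j → f j ≡ 0ℚ)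
  → Σ[ f ] ≡ Σ[ (λ j → below (toℕ j) (toℕ i) (f j)) ] + f i
Σ-split-at f i above = begin
    Σ[ f ]
  ≡⟨ Σ-cong (λ j → below+notBelow (toℕ j) (toℕ i) (f j)) ⟩
    Σ[ (λ j → lower j + notBelow (toℕ j) (toℕ i) (f j)) ]
  ≡⟨ Σ-+ lower (λ j → notBelow (toℕ j) (toℕ i) (f j)) ⟩
    Σ[ lower ] + Σ[ (λ j → notBelow (toℕ j) (toℕ i) (f j)) ]
  ≡⟨ cong (_+_ (Σ[ lower ])) (trans (Σ-single _ i others) (notBelow-no {toℕ i} (f i) (ℕP.<-irrefl refl))) ⟩
    Σ[ lower ] + f i ∎
  where
    open ≡-Reasoning
    lower : Fin _ → ℚ
    lower j = below (toℕ j) (toℕ i) (f j)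
    others : ∀ j → j ≢ i → notBelow (toℕ j) (toℕ i) (f j) ≡ 0ℚ
    others j j≢i = notBelow-vanish (toℕ j) (toℕ i) (λ j≮i →
      above j (ℕP.≤∧≢⇒< (ℕP.≮⇒≥ j≮i) (λ e → j≢i (FP.toℕ-injective (sym e)))))

inv : ℚ → ℚ
inv q = 1ℚ /ℚ q

div-inv : ∀ p q → p /ℚ q ≡ p * inv q
div-inv p q with q QP.≟ 0ℚ
... | yes _ = sym (QP.*-zeroʳ p)
... | no  _ = cong (p *_) (sym (QP.*-identityˡ _))

*-inv : ∀ q → q ≢ 0ℚ → q * inv q ≡ 1ℚ
*-inv q q≢0 with q QP.≟ 0ℚ
... | yes q≡0 = ⊥-elim (q≢0 q≡0)
... | no  q≢0' = trans (cong (q *_) (QP.*-identityˡ _)) (QP.*-inverseʳ q {{≢-nonZero q≢0'}})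

div-* : ∀ p q → q ≢ 0ℚ → (p /ℚ q) * q ≡ p
div-* p q q≢0 = begin
    (p /ℚ q) * q     ≡⟨ cong (_* q) (div-inv p q) ⟩
    p * inv q * q    ≡⟨ solve 3 (λ p i q → p :* i :* q := p :* (q :* i)) refl p (inv q) q ⟩
    p * (q * inv q)  ≡⟨ cong (p *_) (*-inv q q≢0) ⟩
    p * 1ℚ           ≡⟨ QP.*-identityʳ p ⟩
    p                ∎
  where open ≡-Reasoning

*-div : ∀ p q → q ≢ 0ℚ → (p * q) /ℚ q ≡ p
*-div p q q≢0 = begin
    (p * q) /ℚ q     ≡⟨ div-inv (p * q) q ⟩
    p * q * inv q    ≡⟨ QP.*-assoc p q (inv q) ⟩
    p * (q * inv q)  ≡⟨ cong (p *_) (*-inv q q≢0) ⟩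
    p * 1ℚ           ≡⟨ QP.*-identityʳ p ⟩
    p                ∎
  where open ≡-Reasoning

inv≢0 : ∀ q → q ≢ 0ℚ → inv q ≢ 0ℚ
inv≢0 q q≢0 inv≡0 = QP.1≢0 (trans (sym (*-inv q q≢0)) (trans (cong (q *_) inv≡0) (QP.*-zeroʳ q)))

*-nonneg : ∀ {p q} → 0ℚ ≤ p → 0ℚ ≤ q → 0ℚ ≤ p * q
*-nonneg {p} {q} 0≤p 0≤q =
  QP.nonNegative⁻¹ (p * q) {{QP.nonNeg*nonNeg⇒nonNeg p {{nonNegative 0≤p}} q {{nonNegative 0≤q}}}}

square-nonneg : ∀ x → 0ℚ ≤ x * x
square-nonneg x with QP.≤-total 0ℚ x
... | inj₁ 0≤x = *-nonneg 0≤x 0≤x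
... | inj₂ x≤0 = QP.nonNegative⁻¹ (x * x) {{QP.nonPos*nonPos⇒nonPos x {{nonPositive x≤0}} x {{nonPositive x≤0}}}}

square-zero : ∀ x → x * x ≡ 0ℚ → x ≡ 0ℚ
square-zero x xx≡0 with x QP.≟ 0ℚ
... | yes x≡0 = x≡0
... | no  x≢0 = ⊥-elim (x≢0 (begin
    x                ≡⟨ sym (QP.*-identityʳ x) ⟩
    x * 1ℚ           ≡⟨ cong (x *_) (sym (*-inv x x≢0)) ⟩
    x * (x * inv x)  ≡⟨ sym (QP.*-assoc x x (inv x)) ⟩
    x * x * inv x    ≡⟨ cong (_* inv x) xx≡0 ⟩
    0ℚ * inv x       ≡⟨ QP.*-zeroˡ (inv x) ⟩
    0ℚ               ∎))
  where open ≡-Reasoning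

inv-nonneg : ∀ a → 0ℚ ≤ a → a ≢ 0ℚ → 0ℚ ≤ inv a
inv-nonneg a 0≤a a≢0 = subst (0ℚ ≤_) a/a² (*-nonneg 0≤a (square-nonneg (inv a)))
  where
    a/a² : a * (inv a * inv a) ≡ inv a
    a/a² = trans (sym (QP.*-assoc a (inv a) (inv a))) (trans (cong (_* inv a) (*-inv a a≢0)) (QP.*-identityˡ (inv a)))

nonneg-sum-zero : ∀ {a b} → 0ℚ ≤ a → 0ℚ ≤ b → a + b ≡ 0ℚ → a ≡ 0ℚ
nonneg-sum-zero {a} {b} 0≤a 0≤b a+b≡0 =
  QP.≤-antisym (subst₂ _≤_ (QP.+-identityʳ a) a+b≡0 (QP.+-monoʳ-≤ a 0≤b)) 0≤a

lovász-reciprocal : ∀ δ g a b → 0ℚ ≤ a → a ≢ 0ℚ → 0ℚ ≤ b → b ≢ 0ℚ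
  → δ * a ≤ g * a + b → δ * inv b ≤ g * inv b + inv a
lovász-reciprocal δ g a b 0≤a a≢0 0≤b b≢0 lovász =
  subst₂ _≤_ left right (QP.*-monoʳ-≤-nonNeg r {{nonNegative 0≤r}} lovász)
  where
    r = inv a * inv b
    0≤r : 0ℚ ≤ r
    0≤r = *-nonneg (inv-nonneg a 0≤a a≢0) (inv-nonneg b 0≤b b≢0)
    left : δ * a * r ≡ δ * inv b
    left = trans (solve 4 (λ δ a ia ib → δ :* a :* (ia :* ib) := δ :* ib :* (a :* ia)) refl δ a (inv a) (inv b))
                 (trans (cong (δ * inv b *_) (*-inv a a≢0)) (QP.*-identityʳ _))
    right : (g * a + b) * r ≡ g * inv b + inv a
    right = trans (solve 5 (λ g a b ia ib → (g :* a :+ b) :* (ia :* ib) := g :* ib :* (a :* ia) :+ ia :* (b :* ib))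
                         refl g a b (inv a) (inv b))
                  (trans (cong₂ (λ x y → g * inv b * x + inv a * y) (*-inv a a≢0) (*-inv b b≢0))
                         (cong₂ _+_ (QP.*-identityʳ (g * inv b)) (QP.*-identityʳ (inv a))))

⟨⟩-cong : ∀ {n} {u u' v v' : Vecℚ n} → (∀ k → u k ≡ u' k) → (∀ k → v k ≡ v' k) → ⟨ u , v ⟩ ≡ ⟨ u' , v' ⟩
⟨⟩-cong u≗u' v≗v' = Σ-cong (λ k → cong₂ _*_ (u≗u' k) (v≗v' k))

⟨⟩-comm : ∀ {n} (u v : Vecℚ n) → ⟨ u , v ⟩ ≡ ⟨ v , u ⟩
⟨⟩-comm u v = Σ-cong (λ k → QP.*-comm (u k) (v k))

⟨⟩-scaleʳ : ∀ {n} (c : ℚ) (u v : Vecℚ n) → ⟨ u , c · v ⟩ ≡ c * ⟨ u , v ⟩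
⟨⟩-scaleʳ c u v =
  trans (Σ-cong (λ k → solve 3 (λ c a b → a :* (c :* b) := c :* (a :* b)) refl c (u k) (v k)))
        (sym (Σ-*ˡ c (λ k → u k * v k)))

⟨⟩-minus-Σ : ∀ {n k} (a : Vecℚ n) (g : Fin k → Vecℚ n) (v : Vecℚ n)
  → ⟨ (λ t → a t - Σ[ (λ j → g j t) ]) , v ⟩ ≡ ⟨ a , v ⟩ - Σ[ (λ j → ⟨ g j , v ⟩) ]
⟨⟩-minus-Σ a g v = begin
    Σ[ (λ t → (a t - Σ[ (λ j → g j t) ]) * v t) ]
  ≡⟨ Σ-cong (λ t → trans (solve 3 (λ a s v → (a :- s) :* v := a :* v :- s :* v) refl (a t) (Σ[ (λ j → g j t) ]) (v t))
                         (cong (_-_ (a t * v t)) (Σ-*ʳ (v t) (λ j → g j t)))) ⟩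
    Σ[ (λ t → a t * v t - Σ[ (λ j → g j t * v t) ]) ]
  ≡⟨ Σ-- (λ t → a t * v t) (λ t → Σ[ (λ j → g j t * v t) ]) ⟩
    ⟨ a , v ⟩ - Σ[ (λ t → Σ[ (λ j → g j t * v t) ]) ]
  ≡⟨ cong (_-_ ⟨ a , v ⟩) (Σ-swap (λ t j → g j t * v t)) ⟩
    ⟨ a , v ⟩ - Σ[ (λ j → ⟨ g j , v ⟩) ] ∎
  where open ≡-Reasoning

⟨⟩-below : ∀ {n} a b (c : ℚ) (x v : Vecℚ n)
  → ⟨ (λ t → below a b (c * x t)) , v ⟩ ≡ below a b (c * ⟨ x , v ⟩)
⟨⟩-below a b c x v with a ℕ.<? b
... | yes _ = trans (Σ-cong (λ k → QP.*-assoc c (x k) (v k))) (sym (Σ-*ˡ c (λ k → x k * v k)))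
... | no  _ = Σ-zero (λ k → QP.*-zeroˡ (v k))

‖‖²-nonneg : ∀ {n} (v : Vecℚ n) → 0ℚ ≤ ‖ v ‖²
‖‖²-nonneg v = Σ-nonneg _ (λ k → square-nonneg (v k))

‖‖²-zero : ∀ {n} (v : Vecℚ n) → ‖ v ‖² ≡ 0ℚ → ∀ k → v k ≡ 0ℚ
‖‖²-zero {suc n} v ‖v‖²≡0 zero = square-zero (v zero) head≡0
  where head≡0 = nonneg-sum-zero (square-nonneg (v zero)) (‖‖²-nonneg (λ k → v (suc k))) ‖v‖²≡0
‖‖²-zero {suc n} v ‖v‖²≡0 (suc k) = ‖‖²-zero (λ k → v (suc k)) tail≡0 k
  where
    head≡0 = nonneg-sum-zero (square-nonneg (v zero)) (‖‖²-nonneg (λ k → v (suc k))) ‖v‖²≡0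
    tail≡0 = trans (sym (QP.+-identityˡ _)) (trans (cong (_+ ‖ (λ k → v (suc k)) ‖²) (sym head≡0)) ‖v‖²≡0)

orthogonal-coeff : ∀ {k n} (v : Fin k → Vecℚ n) → (∀ i l → i ≢ l → ⟨ v i , v l ⟩ ≡ 0ℚ)
  → (w : Vecℚ n) (y : Fin k → ℚ) → (∀ t → w t ≡ Σ[ (λ l → y l * v l t) ])
  → ∀ l → ⟨ w , v l ⟩ ≡ y l * ‖ v l ‖²
orthogonal-coeff v orth w y w≡Σyv l = begin
    Σ[ (λ t → w t * v l t) ]
  ≡⟨ Σ-cong (λ t → trans (cong (_* v l t) (w≡Σyv t)) (Σ-*ʳ (v l t) (λ l' → y l' * v l' t))) ⟩
    Σ[ (λ t → Σ[ (λ l' → y l' * v l' t * v l t) ]) ]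
  ≡⟨ Σ-swap (λ t l' → y l' * v l' t * v l t) ⟩
    Σ[ (λ l' → Σ[ (λ t → y l' * v l' t * v l t) ]) ]
  ≡⟨ Σ-cong (λ l' → trans (Σ-cong (λ t → QP.*-assoc (y l') (v l' t) (v l t)))
                          (sym (Σ-*ˡ (y l') (λ t → v l' t * v l t)))) ⟩
    Σ[ (λ l' → y l' * ⟨ v l' , v l ⟩) ]
  ≡⟨ Σ-single (λ l' → y l' * ⟨ v l' , v l ⟩) l (λ l' l'≢l → trans (cong (y l' *_) (orth l' l l'≢l)) (QP.*-zeroʳ (y l'))) ⟩
    y l * ‖ v l ‖² ∎
  where open ≡-Reasoning

orthogonal-expansion : ∀ {k n} (v : Fin k → Vecℚ n) → (∀ i l → i ≢ l → ⟨ v i , v l ⟩ ≡ 0ℚ)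
  → (∀ l → ‖ v l ‖² ≢ 0ℚ) → (w : Vecℚ n)
  → (∃ λ (y : Fin k → ℚ) → ∀ t → w t ≡ Σ[ (λ l → y l * v l t) ])
  → ∀ t → w t ≡ Σ[ (λ l → (⟨ w , v l ⟩ /ℚ ‖ v l ‖²) * v l t) ]
orthogonal-expansion v orth v≢0 w (y , w≡Σyv) t = trans (w≡Σyv t) (Σ-cong (λ l → cong (_* v l t) (sym (coeff l))))
  where
    coeff : ∀ l → ⟨ w , v l ⟩ /ℚ ‖ v l ‖² ≡ y l
    coeff l = trans (cong (_/ℚ ‖ v l ‖²) (orthogonal-coeff v orth w y w≡Σyv l)) (*-div (y l) _ (v≢0 l))

unitVec : ∀ {m} → Fin m → Vecℚ m
unitVec i j with j FP.≟ i
... | yes _ = 1ℚ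
... | no  _ = 0ℚ

row-∈row : ∀ {m n} (A : Mat m n) i → A i ∈row A
row-∈row A i = unitVec i , λ t → trans (Σ-single _ i (off t)) (diag t)
  where
    off : ∀ t j → j ≢ i → unitVec i j * A j t ≡ 0ℚ
    off t j j≢i with j FP.≟ i
    ... | yes j≡i = ⊥-elim (j≢i j≡i)
    ... | no  _   = QP.*-zeroˡ (A j t)
    diag : ∀ t → unitVec i i * A i t ≡ A i t
    diag t with i FP.≟ i
    ... | yes _   = QP.*-identityˡ (A i t)
    ... | no  i≢i = ⊥-elim (i≢i refl)

rightInverse-diag : ∀ {m n} (A D : Mat m n) → RightInverseT A D → ∀ i → ⟨ A i , D i ⟩ ≡ 1ℚ
rightInverse-diag A D AD=I zero    = AD=I zero zero
rightInverse-diag A D AD=I (suc i) =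
  rightInverse-diag (λ k → A (suc k)) (λ k → D (suc k)) (λ a b → AD=I (suc a) (suc b)) i

rightInverse-off : ∀ {m n} (A D : Mat m n) → RightInverseT A D → ∀ i j → i ≢ j → ⟨ A i , D j ⟩ ≡ 0ℚ
rightInverse-off A D AD=I zero    zero    i≢j = ⊥-elim (i≢j refl)
rightInverse-off A D AD=I zero    (suc j) i≢j = AD=I zero (suc j)
rightInverse-off A D AD=I (suc i) zero    i≢j = AD=I (suc i) zero
rightInverse-off A D AD=I (suc i) (suc j) i≢j =
  rightInverse-off (λ k → A (suc k)) (λ k → D (suc k)) (λ a b → AD=I (suc a) (suc b)) i j (λ e → i≢j (cong suc e))

adjacent⇒< : ∀ {a b} → a ≡ suc b → b ℕ.< a
adjacent⇒< refl = ℕP.≤-refl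

opposite-< : ∀ {m} (i j : Fin m) → toℕ i ℕ.< toℕ j → toℕ (opposite j) ℕ.< toℕ (opposite i)
opposite-< i j i<j = subst₂ ℕ._<_ (sym (FP.opposite-prop j)) (sym (FP.opposite-prop i))
                               (ℕP.∸-monoʳ-< (ℕ.s≤s i<j) (FP.toℕ<n j))

opposite-adjacent : ∀ {m} (i i' : Fin m) → toℕ i' ≡ suc (toℕ i) → toℕ (opposite i) ≡ suc (toℕ (opposite i'))
opposite-adjacent {m} i i' i'=i+1 = begin
    toℕ (opposite i)           ≡⟨ FP.opposite-prop i ⟩
    m ℕ.∸ suc (toℕ i)          ≡⟨ cong (m ℕ.∸_) (sym i'=i+1) ⟩
    m ℕ.∸ toℕ i'               ≡⟨ ℕP.+-∸-assoc 1 (FP.toℕ<n i') ⟩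
    suc (m ℕ.∸ suc (toℕ i'))   ≡⟨ cong suc (sym (FP.opposite-prop i')) ⟩
    suc (toℕ (opposite i'))    ∎
  where open ≡-Reasoning

initRows : ∀ {m n} → Mat (suc m) n → Mat m n
initRows c i = c (inject₁ i)

snoc-inject₁ : ∀ {m} {A : Set} (f : Fin m → A) a j → snoc f a (inject₁ j) ≡ f j
snoc-inject₁ {suc m} f a zero    = refl
snoc-inject₁ {suc m} f a (suc j) = snoc-inject₁ (λ j → f (suc j)) a j

snoc-last : ∀ {m} {A : Set} (f : Fin m → A) a → snoc f a (fromℕ m) ≡ a
snoc-last {zero}  f a = refl
snoc-last {suc m} f a = snoc-last (λ j → f (suc j)) a

gso-inject₁ : ∀ {m n} (c : Mat (suc m) n) j → gso c (inject₁ j) ≡ gso (initRows c) j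
gso-inject₁ c j = snoc-inject₁ (gso (initRows c)) _ j

gso-last : ∀ {m n} (c : Mat (suc m) n) → gso c (fromℕ m) ≡
  c (fromℕ m) ⊖ ΣV (λ j → (⟨ c (fromℕ m) , gso (initRows c) j ⟩ /ℚ ‖ gso (initRows c) j ‖²) · gso (initRows c) j)
gso-last c = snoc-last (gso (initRows c)) _

gsCoeff-inject₁ : ∀ {m n} (c : Mat (suc m) n) i j
  → gsCoeff c i (inject₁ j) ≡ ⟨ c i , gso (initRows c) j ⟩ /ℚ ‖ gso (initRows c) j ‖²
gsCoeff-inject₁ c i j = cong (λ v → ⟨ c i , v ⟩ /ℚ ‖ v ‖²) (gso-inject₁ c j)

-- cᵢ* = cᵢ − Σ_{j<i} γᵢⱼ cⱼ*, for every row i (not only the last one).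
gso-formula : ∀ {m n} (c : Mat m n) i t
  → gso c i t ≡ c i t - Σ[ (λ j → below (toℕ j) (toℕ i) (gsCoeff c i j * gso c j t)) ]
gso-formula {suc m} c i t with view i
... | ‵fromℕ = begin
    gso c (fromℕ m) t
  ≡⟨ cong (λ v → v t) (gso-last c) ⟩
    c (fromℕ m) t - Σ[ (λ j → (⟨ c (fromℕ m) , gso c⁻ j ⟩ /ℚ ‖ gso c⁻ j ‖²) * gso c⁻ j t) ]
  ≡⟨ cong (_-_ (c (fromℕ m) t)) (sym (trans (Σ-drop-last term last-term) (Σ-cong earlier-term))) ⟩
    c (fromℕ m) t - Σ[ term ] ∎
  where
    open ≡-Reasoning
    c⁻ = initRows c
    term : Fin (suc m) → ℚ
    term j = below (toℕ j) (toℕ (fromℕ m)) (gsCoeff c (fromℕ m) j * gso c j t)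
    last-term : term (fromℕ m) ≡ 0ℚ
    last-term = below-vanish (toℕ (fromℕ m)) (toℕ (fromℕ m)) (λ m<m → ⊥-elim (ℕP.<-irrefl refl m<m))
    earlier-term : ∀ j → term (inject₁ j) ≡ (⟨ c (fromℕ m) , gso c⁻ j ⟩ /ℚ ‖ gso c⁻ j ‖²) * gso c⁻ j t
    earlier-term j =
      trans (below-yes _ (subst (toℕ (inject₁ j) ℕ.<_) (sym (FP.toℕ-fromℕ m)) (FP.inject₁ℕ< j)))
            (cong₂ _*_ (gsCoeff-inject₁ c (fromℕ m) j) (cong (λ v → v t) (gso-inject₁ c j)))
... | ‵inject₁ i = begin
    gso c (inject₁ i) t
  ≡⟨ cong (λ v → v t) (gso-inject₁ c i) ⟩
    gso c⁻ i t
  ≡⟨ gso-formula c⁻ i t ⟩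
    c⁻ i t - Σ[ (λ j → below (toℕ j) (toℕ i) (gsCoeff c⁻ i j * gso c⁻ j t)) ]
  ≡⟨ cong (_-_ (c⁻ i t)) (sym (trans (Σ-drop-last term last-term) (Σ-cong earlier-term))) ⟩
    c (inject₁ i) t - Σ[ term ] ∎
  where
    open ≡-Reasoning
    c⁻ = initRows c
    term : Fin (suc m) → ℚ
    term j = below (toℕ j) (toℕ (inject₁ i)) (gsCoeff c (inject₁ i) j * gso c j t)
    last-term : term (fromℕ m) ≡ 0ℚ
    last-term = below-vanish (toℕ (fromℕ m)) (toℕ (inject₁ i)) (λ m<i → ⊥-elim (ℕP.<-asym m<i
                  (subst (toℕ (inject₁ i) ℕ.<_) (sym (FP.toℕ-fromℕ m)) (FP.inject₁ℕ< i))))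
    earlier-term : ∀ j → term (inject₁ j) ≡ below (toℕ j) (toℕ i) (gsCoeff c⁻ i j * gso c⁻ j t)
    earlier-term j =
      trans (cong₂ (λ a b → below a b (gsCoeff c (inject₁ i) (inject₁ j) * gso c (inject₁ j) t))
                   (FP.toℕ-inject₁ j) (FP.toℕ-inject₁ i))
            (below-cong (toℕ j) (toℕ i) (λ _ → cong₂ _*_ (gsCoeff-inject₁ c (inject₁ i) j) (cong (λ v → v t) (gso-inject₁ c j))))

gso-formula-⟨⟩ : ∀ {m n} (c : Mat m n) i (v : Vecℚ n)
  → ⟨ gso c i , v ⟩ ≡ ⟨ c i , v ⟩ - Σ[ (λ j → below (toℕ j) (toℕ i) (gsCoeff c i j * ⟨ gso c j , v ⟩)) ]
gso-formula-⟨⟩ c i v =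
  trans (⟨⟩-cong (gso-formula c i) (λ _ → refl))
        (trans (⟨⟩-minus-Σ (c i) (λ j t → below (toℕ j) (toℕ i) (gsCoeff c i j * gso c j t)) v)
               (cong (_-_ ⟨ c i , v ⟩) (Σ-cong (λ j → ⟨⟩-below (toℕ j) (toℕ i) (gsCoeff c i j) (gso c j) v))))

row-from-gso : ∀ {m n} (c : Mat m n) j t
  → c j t ≡ gso c j t + Σ[ (λ l → below (toℕ l) (toℕ j) (gsCoeff c j l) * gso c l t) ]
row-from-gso c j t =
  trans (solve 2 (λ x s → x := (x :- s) :+ s) refl (c j t) S)
        (cong₂ _+_ (sym (gso-formula c j t)) (Σ-cong (λ l → sym (below-*ʳ (toℕ l) (toℕ j) (gsCoeff c j l) (gso c l t)))))
  where S = Σ[ (λ l → below (toℕ l) (toℕ j) (gsCoeff c j l * gso c l t)) ]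

module ReciprocalBasis {m n} (B D : Mat m n) (BDᵀ=I : RightInverseT B D) (row-eq : SameRowSpace D B) where

  b* : Mat m n
  b* = gso B

  N : Fin m → ℚ
  N j = ‖ b* j ‖²

  D⁽²⁾ : Mat m n
  D⁽²⁾ = revRows D

  o : Fin m → Fin m
  o = opposite

  -- ⟨b*ⱼ, Dᵢ⟩ = ⟨bⱼ, Dᵢ⟩ for j ≤ i: the correction terms of b*ⱼ involve ⟨b*ₗ, Dᵢ⟩
  -- with l < j ≤ i, which vanish by induction (on a bound k > j) as ⟨bₗ, Dᵢ⟩ = 0.
  pairing-upto : ∀ k (j i : Fin m) → toℕ j ℕ.< k → toℕ j ℕ.≤ toℕ i → ⟨ b* j , D i ⟩ ≡ ⟨ B j , D i ⟩
  pairing-upto (suc k) j i j<1+k j≤i = begin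
      ⟨ b* j , D i ⟩
    ≡⟨ gso-formula-⟨⟩ B j (D i) ⟩
      ⟨ B j , D i ⟩ - Σ[ (λ l → below (toℕ l) (toℕ j) (gsCoeff B j l * ⟨ b* l , D i ⟩)) ]
    ≡⟨ cong (_-_ ⟨ B j , D i ⟩) (Σ-zero (λ l → below-vanish (toℕ l) (toℕ j) (λ l<j →
         trans (cong (gsCoeff B j l *_) (earlier l l<j)) (QP.*-zeroʳ (gsCoeff B j l))))) ⟩
      ⟨ B j , D i ⟩ - 0ℚ
    ≡⟨ QP.+-identityʳ _ ⟩
      ⟨ B j , D i ⟩ ∎
    where
      open ≡-Reasoning
      earlier : ∀ l → toℕ l ℕ.< toℕ j → ⟨ b* l , D i ⟩ ≡ 0ℚ
      earlier l l<j = trans (pairing-upto k l i (ℕP.<-≤-trans l<j (ℕ.s≤s⁻¹ j<1+k)) (ℕP.<⇒≤ l<i))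
                            (rightInverse-off B D BDᵀ=I l i (FP.<⇒≢ l<i))
        where l<i = ℕP.<-≤-trans l<j j≤i

  pairing-self : ∀ i → ⟨ b* i , D i ⟩ ≡ 1ℚ
  pairing-self i = trans (pairing-upto (suc (toℕ i)) i i ℕP.≤-refl ℕP.≤-refl) (rightInverse-diag B D BDᵀ=I i)

  pairing-before : ∀ j i → toℕ j ℕ.< toℕ i → ⟨ b* j , D i ⟩ ≡ 0ℚ
  pairing-before j i j<i =
    trans (pairing-upto (suc (toℕ j)) j i ℕP.≤-refl (ℕP.<⇒≤ j<i)) (rightInverse-off B D BDᵀ=I j i (FP.<⇒≢ j<i))

  -- In particular no b*ⱼ is zero (otherwise ⟨b*ⱼ, Dⱼ⟩ = 0).
  N≢0 : ∀ j → N j ≢ 0ℚ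
  N≢0 j Nj≡0 = QP.1≢0 (trans (sym (pairing-self j))
    (Σ-zero (λ t → trans (cong (_* D j t) (‖‖²-zero (b* j) Nj≡0 t)) (QP.*-zeroˡ (D j t)))))

  -- b*ᵢ ⊥ b*ₗ for l < i (strong induction on i via the bound k): in the formula for
  -- b*ᵢ the terms j ≠ l are orthogonal to b*ₗ, and the term j = l cancels ⟨bᵢ, b*ₗ⟩.
  orthogonal-upto : ∀ k (i l : Fin m) → toℕ l ℕ.< toℕ i → toℕ i ℕ.< k → ⟨ b* i , b* l ⟩ ≡ 0ℚ
  orthogonal-upto (suc k) i l l<i i<1+k = begin
      ⟨ b* i , b* l ⟩
    ≡⟨ gso-formula-⟨⟩ B i (b* l) ⟩
      ⟨ B i , b* l ⟩ - Σ[ (λ j → below (toℕ j) (toℕ i) (gsCoeff B i j * ⟨ b* j , b* l ⟩)) ]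
    ≡⟨ cong (_-_ ⟨ B i , b* l ⟩) (trans (Σ-single _ l others) l-term) ⟩
      ⟨ B i , b* l ⟩ - ⟨ B i , b* l ⟩
    ≡⟨ QP.+-inverseʳ ⟨ B i , b* l ⟩ ⟩
      0ℚ ∎
    where
      open ≡-Reasoning
      i≤k = ℕ.s≤s⁻¹ i<1+k
      earlier : ∀ j → j ≢ l → toℕ j ℕ.< toℕ i → ⟨ b* j , b* l ⟩ ≡ 0ℚ
      earlier j j≢l j<i with ℕP.<-cmp (toℕ j) (toℕ l)
      ... | tri< j<l _ _ = trans (⟨⟩-comm (b* j) (b* l)) (orthogonal-upto k l j j<l (ℕP.<-≤-trans l<i i≤k))
      ... | tri≈ _ j=l _ = ⊥-elim (j≢l (FP.toℕ-injective j=l))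
      ... | tri> _ _ l<j = orthogonal-upto k j l l<j (ℕP.<-≤-trans j<i i≤k)
      others : ∀ j → j ≢ l → below (toℕ j) (toℕ i) (gsCoeff B i j * ⟨ b* j , b* l ⟩) ≡ 0ℚ
      others j j≢l = below-vanish (toℕ j) (toℕ i) (λ j<i →
        trans (cong (gsCoeff B i j *_) (earlier j j≢l j<i)) (QP.*-zeroʳ (gsCoeff B i j)))
      l-term : below (toℕ l) (toℕ i) (gsCoeff B i l * N l) ≡ ⟨ B i , b* l ⟩
      l-term = trans (below-yes _ l<i) (div-* ⟨ B i , b* l ⟩ (N l) (N≢0 l))

  orthogonal : ∀ i l → i ≢ l → ⟨ b* i , b* l ⟩ ≡ 0ℚ
  orthogonal i l i≢l with ℕP.<-cmp (toℕ i) (toℕ l)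
  ... | tri< i<l _ _ = trans (⟨⟩-comm (b* i) (b* l)) (orthogonal-upto (suc (toℕ l)) l i i<l ℕP.≤-refl)
  ... | tri≈ _ i=l _ = ⊥-elim (i≢l (FP.toℕ-injective i=l))
  ... | tri> _ _ l<i = orthogonal-upto (suc (toℕ i)) i l l<i ℕP.≤-refl

  -- Every vector of row(B) is a combination of the b*ₗ: substitute row-from-gso
  -- for each bⱼ and collect the coefficient of each b*ₗ.
  row-in-span : ∀ v → v ∈row B → ∃ λ (y : Vecℚ m) → ∀ t → v t ≡ Σ[ (λ l → y l * b* l t) ]
  row-in-span v (x , x·B=v) = y , expand
    where
      c : Fin m → Fin m → ℚ
      c j l = x j * below (toℕ l) (toℕ j) (gsCoeff B j l)
      y : Vecℚ m
      y l = x l + Σ[ (λ j → c j l) ]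
      distribute : ∀ j t → x j * B j t ≡ x j * b* j t + Σ[ (λ l → c j l * b* l t) ]
      distribute j t =
        trans (cong (x j *_) (row-from-gso B j t))
              (trans (QP.*-distribˡ-+ (x j) (b* j t) _)
                     (cong (_+_ (x j * b* j t))
                           (trans (Σ-*ˡ (x j) (λ l → below (toℕ l) (toℕ j) (gsCoeff B j l) * b* l t)) (Σ-cong (λ l → sym (QP.*-assoc (x j) _ (b* l t)))))))
      expand : ∀ t → v t ≡ Σ[ (λ l → y l * b* l t) ]
      expand t = begin
          v t
        ≡⟨ sym (x·B=v t) ⟩
          Σ[ (λ j → x j * B j t) ]
        ≡⟨ Σ-cong (λ j → distribute j t) ⟩
          Σ[ (λ j → x j * b* j t + Σ[ (λ l → c j l * b* l t) ]) ]
        ≡⟨ Σ-+ (λ j → x j * b* j t) (λ j → Σ[ (λ l → c j l * b* l t) ]) ⟩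
          Σ[ (λ j → x j * b* j t) ] + Σ[ (λ j → Σ[ (λ l → c j l * b* l t) ]) ]
        ≡⟨ cong (_+_ (Σ[ (λ j → x j * b* j t) ])) (Σ-swap (λ j l → c j l * b* l t)) ⟩
          Σ[ (λ l → x l * b* l t) ] + Σ[ (λ l → Σ[ (λ j → c j l * b* l t) ]) ]
        ≡⟨ sym (Σ-+ (λ l → x l * b* l t) (λ l → Σ[ (λ j → c j l * b* l t) ])) ⟩
          Σ[ (λ l → x l * b* l t + Σ[ (λ j → c j l * b* l t) ]) ]
        ≡⟨ Σ-cong (λ l → trans (cong (_+_ (x l * b* l t)) (sym (Σ-*ʳ (b* l t) (λ j → c j l))))
                               (sym (QP.*-distribʳ-+ (b* l t) (x l) _))) ⟩
          Σ[ (λ l → y l * b* l t) ] ∎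
        where open ≡-Reasoning

  component : Vecℚ n → Fin m → Vecℚ n
  component u l t = (⟨ u , b* l ⟩ /ℚ N l) * b* l t

  D-expansion : ∀ i t → D i t ≡ Σ[ (λ l → component (D i) l t) ]
  D-expansion i = orthogonal-expansion b* orthogonal N≢0 (D i)
                    (row-in-span (D i) (Equivalence.to (row-eq (D i)) (row-∈row D i)))

  -- For k = k' + 1: ⟨Dₖ', b*ₖ⟩ = −αₖₖ'. In b*ₖ = bₖ − Σ_{l<k} αₖₗ b*ₗ only l = k'
  -- pairs nontrivially with Dₖ': ⟨bₖ, Dₖ'⟩ = 0, ⟨b*ₗ, Dₖ'⟩ = 0 for l < k', ⟨b*ₖ', Dₖ'⟩ = 1.
  adjacent-pairing : ∀ k k' → toℕ k ≡ suc (toℕ k') → ⟨ D k' , b* k ⟩ ≡ - gsCoeff B k k'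
  adjacent-pairing k k' k=k'+1 = begin
      ⟨ D k' , b* k ⟩
    ≡⟨ ⟨⟩-comm (D k') (b* k) ⟩
      ⟨ b* k , D k' ⟩
    ≡⟨ gso-formula-⟨⟩ B k (D k') ⟩
      ⟨ B k , D k' ⟩ - Σ[ (λ l → below (toℕ l) (toℕ k) (gsCoeff B k l * ⟨ b* l , D k' ⟩)) ]
    ≡⟨ cong₂ _-_ (rightInverse-off B D BDᵀ=I k k' k≢k') (trans (Σ-single _ k' others) k'-term) ⟩
      0ℚ - gsCoeff B k k'
    ≡⟨ QP.+-identityˡ _ ⟩
      - gsCoeff B k k' ∎
    where
      open ≡-Reasoning
      k≢k' : k ≢ k'
      k≢k' k≡k' = ℕP.1+n≢n (trans (sym k=k'+1) (cong toℕ k≡k'))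
      others : ∀ l → l ≢ k' → below (toℕ l) (toℕ k) (gsCoeff B k l * ⟨ b* l , D k' ⟩) ≡ 0ℚ
      others l l≢k' = below-vanish (toℕ l) (toℕ k) (λ l<k →
        trans (cong (gsCoeff B k l *_)
                    (pairing-before l k' (ℕP.≤∧≢⇒< (ℕ.s≤s⁻¹ (subst (toℕ l ℕ.<_) k=k'+1 l<k))
                                                   (λ e → l≢k' (FP.toℕ-injective e)))))
              (QP.*-zeroʳ (gsCoeff B k l)))
      k'-term : below (toℕ k') (toℕ k) (gsCoeff B k k' * ⟨ b* k' , D k' ⟩) ≡ gsCoeff B k k'
      k'-term = trans (below-yes _ (adjacent⇒< k=k'+1))
                      (trans (cong (gsCoeff B k k' *_) (pairing-self k')) (QP.*-identityʳ _))

  -- The claimed Gram–Schmidt vectors of D⁽²⁾: d*ᵢ = b*_{o i} / N_{o i}.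
  d* : Mat m n
  d* i = inv (N (o i)) · b* (o i)

  d*-norm : ∀ i → ‖ d* i ‖² ≡ inv (N (o i))
  d*-norm i = begin
      ‖ d* i ‖²
    ≡⟨ ⟨⟩-scaleʳ s (d* i) (b* (o i)) ⟩
      s * ⟨ d* i , b* (o i) ⟩
    ≡⟨ cong (s *_) (trans (⟨⟩-comm (d* i) (b* (o i))) (⟨⟩-scaleʳ s (b* (o i)) (b* (o i)))) ⟩
      s * (s * N (o i))
    ≡⟨ cong (s *_) (trans (QP.*-comm s (N (o i))) (*-inv (N (o i)) (N≢0 (o i)))) ⟩
      s * 1ℚ
    ≡⟨ QP.*-identityʳ s ⟩
      s ∎
    where
      open ≡-Reasoning
      s = inv (N (o i))

  projection-d* : ∀ u j t → (⟨ u , d* j ⟩ /ℚ ‖ d* j ‖²) * d* j t ≡ component u (o j) t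
  projection-d* u j t = begin
      (⟨ u , d* j ⟩ /ℚ ‖ d* j ‖²) * d* j t
    ≡⟨ cong₂ (λ x y → (x /ℚ y) * d* j t) (trans (⟨⟩-scaleʳ s u (b* (o j))) (QP.*-comm s p)) (d*-norm j) ⟩
      ((p * s) /ℚ s) * (s * b* (o j) t)
    ≡⟨ cong (_* (s * b* (o j) t)) (*-div p s (inv≢0 (N (o j)) (N≢0 (o j)))) ⟩
      p * (s * b* (o j) t)
    ≡⟨ sym (QP.*-assoc p s (b* (o j) t)) ⟩
      p * s * b* (o j) t
    ≡⟨ cong (_* b* (o j) t) (sym (div-inv p (N (o j)))) ⟩
      component u (o j) t ∎
    where
      open ≡-Reasoning
      s = inv (N (o j))
      p = ⟨ u , b* (o j) ⟩

  earlier-part : Fin m → Fin n → ℚ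
  earlier-part i t = Σ[ (λ j → below (toℕ j) (toℕ i) (component (D (o i)) (o j) t)) ]

  -- Reindexed by o, the expansion of D⁽²⁾ᵢ is its earlier part plus d*ᵢ: components
  -- with j > i vanish as ⟨b*_{o j}, D_{o i}⟩ = 0, and the j = i component is d*ᵢ.
  D⁽²⁾-split : ∀ i t → D⁽²⁾ i t ≡ earlier-part i t + d* i t
  D⁽²⁾-split i t = begin
      D (o i) t
    ≡⟨ D-expansion (o i) t ⟩
      Σ[ (λ l → component (D (o i)) l t) ]
    ≡⟨ Σ-reverse (λ l → component (D (o i)) l t) ⟩
      Σ[ (λ j → component (D (o i)) (o j) t) ]
    ≡⟨ Σ-split-at _ i later ⟩
      earlier-part i t + component (D (o i)) (o i) t
    ≡⟨ cong (_+_ (earlier-part i t)) (coeff-is (pairing-self (o i))) ⟩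
      earlier-part i t + d* i t ∎
    where
      open ≡-Reasoning
      coeff-is : ∀ {j q} → ⟨ b* (o j) , D (o i) ⟩ ≡ q → component (D (o i)) (o j) t ≡ (q /ℚ N (o j)) * b* (o j) t
      coeff-is {j} e = cong (λ x → (x /ℚ N (o j)) * b* (o j) t) (trans (⟨⟩-comm (D (o i)) (b* (o j))) e)
      later : ∀ j → toℕ i ℕ.< toℕ j → component (D (o i)) (o j) t ≡ 0ℚ
      later j i<j = trans (coeff-is (pairing-before (o j) (o i) (opposite-< i j i<j)))
                          (trans (cong (_* b* (o j) t) (trans (div-inv 0ℚ (N (o j))) (QP.*-zeroˡ (inv (N (o j)))))) (QP.*-zeroˡ (b* (o j) t)))

  -- gso D⁽²⁾ = d*, by strong induction on i (bound k): by induction the Gram–Schmidt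
  -- terms of D⁽²⁾ᵢ are exactly its earlier part, so subtracting them leaves d*ᵢ.
  gso-dual-upto : ∀ k i → toℕ i ℕ.< k → ∀ t → gso D⁽²⁾ i t ≡ d* i t
  gso-dual-upto (suc k) i i<1+k t = begin
      gso D⁽²⁾ i t
    ≡⟨ gso-formula D⁽²⁾ i t ⟩
      D⁽²⁾ i t - Σ[ (λ j → below (toℕ j) (toℕ i) (gsCoeff D⁽²⁾ i j * gso D⁽²⁾ j t)) ]
    ≡⟨ cong (_-_ (D⁽²⁾ i t)) (Σ-cong (λ j → below-cong (toℕ j) (toℕ i) (earlier j))) ⟩
      D⁽²⁾ i t - earlier-part i t
    ≡⟨ cong (λ z → z - earlier-part i t) (D⁽²⁾-split i t) ⟩
      (earlier-part i t + d* i t) - earlier-part i t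
    ≡⟨ solve 2 (λ e d → (e :+ d) :- e := d) refl (earlier-part i t) (d* i t) ⟩
      d* i t ∎
    where
      open ≡-Reasoning
      earlier : ∀ j → toℕ j ℕ.< toℕ i → gsCoeff D⁽²⁾ i j * gso D⁽²⁾ j t ≡ component (D (o i)) (o j) t
      earlier j j<i = trans (cong₂ _*_ (cong₂ _/ℚ_ (⟨⟩-cong {u = D (o i)} (λ _ → refl) IH) (⟨⟩-cong IH IH)) (IH t))
                            (projection-d* (D (o i)) j t)
        where IH = gso-dual-upto k j (ℕP.<-≤-trans j<i (ℕ.s≤s⁻¹ i<1+k))

  gso-dual : ∀ i t → gso D⁽²⁾ i t ≡ d* i t
  gso-dual i = gso-dual-upto (suc (toℕ i)) i ℕP.≤-refl

  dual-norm : ∀ i → ‖ gso D⁽²⁾ i ‖² ≡ inv (N (o i))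
  dual-norm i = trans (⟨⟩-cong (gso-dual i) (gso-dual i)) (d*-norm i)

  dual-coeff : ∀ i i' → gsCoeff D⁽²⁾ i' i ≡ ⟨ D (o i') , b* (o i) ⟩
  dual-coeff i i' = begin
      ⟨ D (o i') , gso D⁽²⁾ i ⟩ /ℚ ‖ gso D⁽²⁾ i ‖²
    ≡⟨ cong₂ _/ℚ_ (trans (⟨⟩-cong {u = D (o i')} (λ _ → refl) (gso-dual i)) (trans (⟨⟩-scaleʳ s (D (o i')) (b* (o i))) (QP.*-comm s p)))
                  (dual-norm i) ⟩
      (p * s) /ℚ s
    ≡⟨ *-div p s (inv≢0 (N (o i)) (N≢0 (o i))) ⟩
      p ∎
    where
      open ≡-Reasoning
      s = inv (N (o i))
      p = ⟨ D (o i') , b* (o i) ⟩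

  dual-adjacent-coeff : ∀ i i' → toℕ i' ≡ suc (toℕ i) → gsCoeff D⁽²⁾ i' i ≡ - gsCoeff B (o i) (o i')
  dual-adjacent-coeff i i' i'=i+1 =
    trans (dual-coeff i i') (adjacent-pairing (o i) (o i') (opposite-adjacent i i' i'=i+1))

  size-reduction-transfers :
      (∀ (i j : Fin m) → toℕ j <ℕ toℕ i → ∣ gsCoeff B i j ∣ ≤ ½)
    → ∀ (i i' : Fin m) → toℕ i' ≡ suc (toℕ i) → ∣ gsCoeff D⁽²⁾ i' i ∣ ≤ ½
  size-reduction-transfers size-reduced i i' i'=i+1 =
    subst (_≤ ½) (sym same-abs) (size-reduced (o i) (o i') (adjacent⇒< (opposite-adjacent i i' i'=i+1)))
    where
      same-abs : ∣ gsCoeff D⁽²⁾ i' i ∣ ≡ ∣ gsCoeff B (o i) (o i') ∣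
      same-abs = trans (cong ∣_∣ (dual-adjacent-coeff i i' i'=i+1)) (QP.∣-p∣≡∣p∣ _)

  -- Part 2: the Lovász inequality of B at (o i', o i), δNₒᵢ' ≤ α²Nₒᵢ' + Nₒᵢ,
  -- becomes that of D⁽²⁾ at (i, i') after dividing by Nₒᵢ' Nₒᵢ.
  lovász-transfers : ∀ δ →
      (∀ (i i' : Fin m) → toℕ i' ≡ suc (toℕ i)
        → δ * ‖ gso B i ‖² ≤ gsCoeff B i' i * gsCoeff B i' i * ‖ gso B i ‖² + ‖ gso B i' ‖²)
    → ∀ (i i' : Fin m) → toℕ i' ≡ suc (toℕ i)
      → δ * ‖ gso D⁽²⁾ i ‖² ≤ gsCoeff D⁽²⁾ i' i * gsCoeff D⁽²⁾ i' i * ‖ gso D⁽²⁾ i ‖² + ‖ gso D⁽²⁾ i' ‖²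
  lovász-transfers δ lovász i i' i'=i+1 =
    subst₂ _≤_ (cong (δ *_) (sym (dual-norm i))) (sym rhs)
      (lovász-reciprocal δ (α * α) (N (o i')) (N (o i)) (‖‖²-nonneg (b* (o i'))) (N≢0 (o i')) (‖‖²-nonneg (b* (o i))) (N≢0 (o i))
                         (lovász (o i') (o i) (opposite-adjacent i i' i'=i+1)))
    where
      α = gsCoeff B (o i) (o i')
      rhs : gsCoeff D⁽²⁾ i' i * gsCoeff D⁽²⁾ i' i * ‖ gso D⁽²⁾ i ‖² + ‖ gso D⁽²⁾ i' ‖²
            ≡ α * α * inv (N (o i)) + inv (N (o i'))
      rhs = cong₂ _+_ (trans (cong₂ (λ x y → x * x * y) (dual-adjacent-coeff i i' i'=i+1) (dual-norm i))
                             (cong (_* inv (N (o i))) (solve 1 (λ a → (:- a) :* (:- a) := a :* a) refl α)))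
                      (dual-norm i')

-- Both parts follow for the dual basis D of B.
theorem11 : ∀ {m n} (B D : Mat m n) (δ : ℚ)
    → IsLatticeBasis B
    → SameRowSpace D B
    → RightInverseT B D
    → (+ 1 / 4) < δ → δ < 1ℚ
    → ((∀ (i j : Fin m) → toℕ j <ℕ toℕ i → ∣ gsCoeff B i j ∣ ≤ ½)
         → ∀ (i i' : Fin m) → toℕ i' ≡ suc (toℕ i) → ∣ gsCoeff (revRows D) i' i ∣ ≤ ½)
      × ((∀ (i i' : Fin m) → toℕ i' ≡ suc (toℕ i)
            → δ * ‖ gso B i ‖² ≤ gsCoeff B i' i * gsCoeff B i' i * ‖ gso B i ‖² + ‖ gso B i' ‖²)
         → ∀ (i i' : Fin m) → toℕ i' ≡ suc (toℕ i)
            → δ * ‖ gso (revRows D) i ‖² ≤ gsCoeff (revRows D) i' i * gsCoeff (revRows D) i' i * ‖ gso (revRows D) i ‖² + ‖ gso (revRows D) i' ‖²)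
theorem11 B D δ _ row-eq BDᵀ=I _ _ = size-reduction-transfers , lovász-transfers δ
  where open ReciprocalBasis B D BDᵀ=I row-eq
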